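{- Let $\mathcal{S}=\{(k_1,\dots,k_r): r\geq 1,\ k_1\geq 2,\ k_2,\dots,k_r\geq 1 \text{ integers}\}$. Define a relation $\succ$ on $\mathcal{S}$ by: $(k_1,\dots,k_r)\succ(m_1,\dots,m_s)$ if either $(m_1,\dots,m_s)$ is a proper initial segment of $(k_1,\dots,k_r)$ (i.e. $s<r$ and $k_i=m_i$ for $1\leq i\leq s$), or there is $j\geq 0$ with $k_i=m_i$ for $1\leq i\leq j$ and $k_{j+1}<m_{j+1}$. Then for all $(k_1,\dots,k_r),(m_1,\dots,m_s)\in\mathcal{S}$, $$(k_1,\dots,k_r)\succ(m_1,\dots,m_s)\iff \zeta^{\star}(k_1,\dots,k_r)>\zeta^{\star}(m_1,\dots,m_s).$$
   Context: For $(k_1,\dots,k_r)\in\mathcal{S}$, $\zeta^{\star}(k_1,\dots,k_r)=\sum_{n_1\geq n_2\geq\cdots\geq n_r\geq 1}\frac{1}{n_1^{k_1}\cdots n_r^{k_r}}$. -}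

module Defs where

open import Data.Nat as ℕ using (ℕ; zero; suc; _^_)
open import Data.Nat.Properties using (m^n≢0)
open import Data.Integer using (+_)
open import Data.Rational as ℚ using (ℚ; 0ℚ; 1ℚ; _+_; _*_; _<_; _≤_)
open import Data.List using (List; []; _∷_; _++_)
open import Data.List.Relation.Unary.All using (All)
open import Data.Product using (Σ; ∃; ∃-syntax; _×_)
open import Relation.Binary.PropositionalEquality using (_≡_)

data InS : List ℕ → Set where
  inS : ∀ {k ks} → 2 ℕ.≤ k → All (1 ℕ.≤_) ks → InS (k ∷ ks)

data _≻_ (ks ms : List ℕ) : Set where
  properPrefix : ∀ x rest → ks ≡ ms ++ (x ∷ rest) → ks ≻ ms
  firstDiff    : ∀ pre a b ks' ms' → ks ≡ pre ++ (a ∷ ks') → ms ≡ pre ++ (b ∷ ms')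
               → a ℕ.< b → ks ≻ ms

-- 1 / n^k for n ≥ 1 (written as suc n).
inv^ : ℕ → ℕ → ℚ
inv^ n k = ℚ._/_ (+ 1) (suc n ^ k) {{m^n≢0 (suc n) k}}

sumTo : ℕ → (ℕ → ℚ) → ℚ
sumTo zero    f = 0ℚ
sumTo (suc N) f = sumTo N f + f (suc N)

-- Truncated zeta-star value:
--   ζ⋆_N(k₁,…,k_r) = Σ_{N ≥ n₁ ≥ n₂ ≥ … ≥ n_r ≥ 1} 1/(n₁^{k₁} ⋯ n_r^{k_r})
--   ζ⋆_N(k₁,k₂,…)  = Σ_{n=1}^{N} n^{-k₁} ζ⋆_n(k₂,…),   ζ⋆_N() = 1.
ζ⋆≤ : List ℕ → ℕ → ℚ
ζ⋆≤ []       N = 1ℚ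
ζ⋆≤ (k ∷ ks) N = sumTo N (λ n → inv^ (ℕ.pred n) k * ζ⋆≤ ks n)

-- ζ⋆(ks) > ζ⋆(ms) as real numbers, where ζ⋆ is the limit of the
-- (monotone, convergent for ks ∈ 𝒮) truncations ζ⋆≤ ks N.
-- For convergent sequences a_N → a, b_N → b one has a > b iff
-- there are a rational ε > 0 and N₀ with b_N + ε ≤ a_N for all N ≥ N₀.
_ζ⋆>_ : List ℕ → List ℕ → Set
ks ζ⋆> ms = ∃[ ε ] (0ℚ < ε × ∃[ N₀ ] (∀ N → N₀ ℕ.≤ N → ζ⋆≤ ms N + ε ≤ ζ⋆≤ ks N))

module Submission where

-- Work with the truncations ζ⋆_N and call X ≫ Y when Y_N ≤ X_N for N ≥ 1
-- and Y_N + ε ≤ X_N for N ≥ 2, with a fixed ε > 0; this gives ks ζ⋆> ms.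
-- The map X ↦ (N ↦ Σ_{n ≤ N} n^{-k} X_n) preserves ≫, so both clauses of ≻
-- reduce to the case of an empty common prefix.  A proper prefix: the terms
-- n = 1, 2 alone give ζ⋆_N(k, …) ≥ 1 + 2^{-k} = ζ⋆_N() + 2^{-k}.  A first
-- difference a ≤ c: if all entries of m are ≥ 1 then N ≫ ζ⋆_N(m), hence
-- Σ_{n ≤ N} n^{-c-1} · n = Σ_{n ≤ N} n^{-c} ≫ ζ⋆_N(c + 1, m), and termwise
-- n^{-c} ≤ n^{-a} ≤ n^{-a} ζ⋆_n(ks).
-- The converse holds because ≻ is trichotomous and ζ⋆> is asymmetric.

open import Defs
open import Algebra.Bundles using (CommutativeMonoid)
open import Data.Empty using (⊥-elim)
open import Data.Integer as ℤ using (+_)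
import Data.Integer.Properties as ℤP
open import Data.List using (List; []; _∷_; _++_)
open import Data.List.Properties using (++-identityʳ)
open import Data.List.Relation.Unary.All using (All; []; _∷_)
open import Data.List.Relation.Unary.All.Properties using (++⁻ʳ)
open import Data.Nat as ℕ using (ℕ; zero; suc; _^_; s≤s; z≤n; _≤′_; ≤′-refl; ≤′-step)
import Data.Nat.Properties as ℕP
open import Data.Product using (_×_; _,_)
open import Data.Rational using (ℚ; 0ℚ; 1ℚ; _/_; _+_; _*_; _<_; _≤_; toℚᵘ; nonNegative; positive)
import Data.Rational.Properties as ℚP
open import Data.Rational.Unnormalised using (mkℚᵘ; 1ℚᵘ; *≡*)
  renaming (_/_ to _/ᵘ_; _+_ to _+ᵘ_; _*_ to _*ᵘ_; _≃_ to _≃ᵘ_)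
import Data.Rational.Unnormalised.Properties as ℚᵘP
open import Data.Sum using (_⊎_; inj₁; inj₂)
open import Relation.Binary.Definitions using (tri<; tri≈; tri>)
open import Relation.Binary.PropositionalEquality
open import Relation.Nullary using (¬_)

open import Algebra.Properties.CommutativeSemigroup
  (CommutativeMonoid.commutativeSemigroup ℚP.+-0-commutativeMonoid) using (xy∙z≈xz∙y)

fromℕ : ℕ → ℚ
fromℕ n = + n / 1

toℚᵘ-/ : ∀ i d .{{_ : ℕ.NonZero d}} → toℚᵘ (i / d) ≃ᵘ i /ᵘ d
toℚᵘ-/ i (suc d) = ℚP.toℚᵘ-fromℚᵘ (mkℚᵘ i d)

/-cross : ∀ a b c d .{{_ : ℕ.NonZero b}} .{{_ : ℕ.NonZero d}} →
          a ℕ.* d ≡ c ℕ.* b → + a / b ≡ + c / d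
/-cross a b@(suc _) c d@(suc _) ad≡cb = ℚP.toℚᵘ-injective (begin
  toℚᵘ (+ a / b)  ≈⟨ toℚᵘ-/ (+ a) b ⟩
  + a /ᵘ b        ≈⟨ *≡* (trans (sym (ℤP.pos-* a d)) (trans (cong +_ ad≡cb) (ℤP.pos-* c b))) ⟩
  + c /ᵘ d        ≈⟨ toℚᵘ-/ (+ c) d ⟨
  toℚᵘ (+ c / d)  ∎)
  where open ℚᵘP.≃-Reasoning

/-* : ∀ a b c d .{{_ : ℕ.NonZero b}} .{{_ : ℕ.NonZero d}} →
      (+ a / b) * (+ c / d) ≡ (+ (a ℕ.* c) / (b ℕ.* d)) {{ℕP.m*n≢0 b d}}
/-* a b@(suc _) c d@(suc _) = ℚP.toℚᵘ-injective (begin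
  toℚᵘ (+ a / b * (+ c / d))             ≈⟨ ℚP.toℚᵘ-homo-* (+ a / b) (+ c / d) ⟩
  toℚᵘ (+ a / b) *ᵘ toℚᵘ (+ c / d)       ≈⟨ ℚᵘP.*-cong (toℚᵘ-/ (+ a) b) (toℚᵘ-/ (+ c) d) ⟩
  (+ a ℤ.* + c) /ᵘ (b ℕ.* d)             ≡⟨ cong (_/ᵘ (b ℕ.* d)) (ℤP.pos-* a c) ⟨
  + (a ℕ.* c) /ᵘ (b ℕ.* d)               ≈⟨ toℚᵘ-/ (+ (a ℕ.* c)) (b ℕ.* d) ⟨
  toℚᵘ (+ (a ℕ.* c) / (b ℕ.* d))         ∎)
  where open ℚᵘP.≃-Reasoning

fromℕ-suc : ∀ n → fromℕ (suc n) ≡ fromℕ n + 1ℚ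
fromℕ-suc n = ℚP.toℚᵘ-injective (begin
  toℚᵘ (fromℕ (suc n))                  ≈⟨ toℚᵘ-/ (+ suc n) 1 ⟩
  + suc n /ᵘ 1                          ≈⟨ *≡* (cong (ℤ._* + 1) integers) ⟩
  + n /ᵘ 1 +ᵘ 1ℚᵘ                       ≈⟨ ℚᵘP.+-cong (toℚᵘ-/ (+ n) 1) ℚᵘP.≃-refl ⟨
  toℚᵘ (fromℕ n) +ᵘ toℚᵘ 1ℚ             ≈⟨ ℚP.toℚᵘ-homo-+ (fromℕ n) 1ℚ ⟨
  toℚᵘ (fromℕ n + 1ℚ)                   ∎)
  where
  open ℚᵘP.≃-Reasoning
  integers : + suc n ≡ + n ℤ.* + 1 ℤ.+ + 1 ℤ.* + 1
  integers = trans (ℤP.pos-+ 1 n) (trans (ℤP.+-comm (+ 1) (+ n))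
             (sym (cong₂ ℤ._+_ (ℤP.*-identityʳ (+ n)) refl)))

inv^-zeroˡ : ∀ k → inv^ 0 k ≡ 1ℚ
inv^-zeroˡ k = ℚP./-cong {+ 1} {{ℕP.m^n≢0 1 k}} refl (ℕP.^-zeroˡ k)

inv^-suc*fromℕ : ∀ n k → inv^ n (suc k) * fromℕ (suc n) ≡ inv^ n k
inv^-suc*fromℕ n k = begin
  inv^ n (suc k) * fromℕ m           ≡⟨ /-* 1 (m ^ suc k) m 1 ⟩
  + (1 ℕ.* m) / (m ^ suc k ℕ.* 1)    ≡⟨ /-cross (1 ℕ.* m) (m ^ suc k ℕ.* 1) 1 (m ^ k) cross ⟩
  inv^ n k                           ∎
  where
  open ≡-Reasoning
  m = suc n
  instance
    m^k≢0     = ℕP.m^n≢0 m k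
    m^1+k≢0   = ℕP.m^n≢0 m (suc k)
    m^1+k*1≢0 = ℕP.m*n≢0 (m ^ suc k) 1
  cross : 1 ℕ.* m ℕ.* m ^ k ≡ 1 ℕ.* (m ^ suc k ℕ.* 1)
  cross = trans (cong (ℕ._* m ^ k) (ℕP.*-identityˡ m))
                (sym (trans (ℕP.*-identityˡ _) (ℕP.*-identityʳ _)))

*-monoˡ-≤-≥0 : ∀ r {p q} → 0ℚ ≤ r → p ≤ q → r * p ≤ r * q
*-monoˡ-≤-≥0 r r≥0 = ℚP.*-monoˡ-≤-nonNeg r {{nonNegative r≥0}}

≤-*-≥1 : ∀ {r p} → 0ℚ ≤ r → 1ℚ ≤ p → r ≤ r * p
≤-*-≥1 {r} {p} r≥0 p≥1 =
  subst (_≤ r * p) (ℚP.*-identityʳ r) (*-monoˡ-≤-≥0 r r≥0 p≥1)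

*-≥0 : ∀ {p q} → 0ℚ ≤ p → 0ℚ ≤ q → 0ℚ ≤ p * q
*-≥0 {p} {q} p≥0 q≥0 = ℚP.nonNegative⁻¹ (p * q)
  {{ℚP.nonNeg*nonNeg⇒nonNeg p {{nonNegative p≥0}} q {{nonNegative q≥0}}}}

*-pos : ∀ {p q} → 0ℚ < p → 0ℚ < q → 0ℚ < p * q
*-pos {p} {q} p>0 q>0 = ℚP.positive⁻¹ (p * q) {{ℚP.pos*pos⇒pos p {{positive p>0}} q {{positive q>0}}}}

fromℕ-nonNeg : ∀ n → 0ℚ ≤ fromℕ n
fromℕ-nonNeg n = ℚP.nonNegative⁻¹ (fromℕ n) {{ℚP.normalize-nonNeg n 1}}

1≤fromℕ-suc : ∀ n → 1ℚ ≤ fromℕ (suc n)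
1≤fromℕ-suc n = subst₂ _≤_ (ℚP.+-identityˡ 1ℚ) (sym (fromℕ-suc n))
  (ℚP.+-monoˡ-≤ 1ℚ (fromℕ-nonNeg n))

inv^-pos : ∀ n k → 0ℚ < inv^ n k
inv^-pos n k = ℚP.positive⁻¹ (inv^ n k) {{ℚP.normalize-pos 1 (suc n ^ k) {{ℕP.m^n≢0 (suc n) k}}}}

inv^-nonNeg : ∀ n k → 0ℚ ≤ inv^ n k
inv^-nonNeg n k = ℚP.<⇒≤ (inv^-pos n k)

inv^-antitone : ∀ n {a b} → a ℕ.≤ b → inv^ n b ≤ inv^ n a
inv^-antitone n a≤b = go (ℕP.≤⇒≤′ a≤b)
  where
  go : ∀ {a b} → a ≤′ b → inv^ n b ≤ inv^ n a
  go ≤′-refl = ℚP.≤-refl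
  go {b = suc b} (≤′-step a≤′b) = ℚP.≤-trans
    (subst (inv^ n (suc b) ≤_) (inv^-suc*fromℕ n b) (≤-*-≥1 (inv^-nonNeg n (suc b)) (1≤fromℕ-suc n)))
    (go a≤′b)

module _ {f g : ℕ → ℚ} (g≤f : ∀ n → g (suc n) ≤ f (suc n)) where

  sumTo-mono : ∀ N → sumTo N g ≤ sumTo N f
  sumTo-mono zero    = ℚP.≤-refl
  sumTo-mono (suc N) = ℚP.+-mono-≤ (sumTo-mono N) (g≤f N)

  sumTo-mono-margin : ∀ {ε} → g 2 + ε ≤ f 2 → ∀ N → sumTo (2 ℕ.+ N) g + ε ≤ sumTo (2 ℕ.+ N) f
  sumTo-mono-margin {ε} margin zero = begin
    sumTo 1 g + g 2 + ε    ≡⟨ ℚP.+-assoc (sumTo 1 g) (g 2) ε ⟩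
    sumTo 1 g + (g 2 + ε)  ≤⟨ ℚP.+-mono-≤ (sumTo-mono 1) margin ⟩
    sumTo 2 f              ∎
    where open ℚP.≤-Reasoning
  sumTo-mono-margin {ε} margin (suc N) = begin
    sumTo (2 ℕ.+ N) g + g (3 ℕ.+ N) + ε    ≡⟨ xy∙z≈xz∙y (sumTo (2 ℕ.+ N) g) (g (3 ℕ.+ N)) ε ⟩
    sumTo (2 ℕ.+ N) g + ε + g (3 ℕ.+ N)    ≤⟨ ℚP.+-mono-≤ (sumTo-mono-margin margin N) (g≤f (2 ℕ.+ N)) ⟩
    sumTo (3 ℕ.+ N) f                      ∎
    where open ℚP.≤-Reasoning

sumTo-monoˡ : ∀ {f : ℕ → ℚ} → (∀ n → 0ℚ ≤ f (suc n)) → ∀ {M N} → M ℕ.≤ N → sumTo M f ≤ sumTo N f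
sumTo-monoˡ {f} f≥0 M≤N = go (ℕP.≤⇒≤′ M≤N)
  where
  go : ∀ {M N} → M ≤′ N → sumTo M f ≤ sumTo N f
  go ≤′-refl = ℚP.≤-refl
  go {N = suc N} (≤′-step M≤′N) = ℚP.≤-trans (go M≤′N)
    (subst (_≤ sumTo (suc N) f) (ℚP.+-identityʳ (sumTo N f)) (ℚP.+-monoʳ-≤ (sumTo N f) (f≥0 N)))

sumTo-1ℚ : ∀ N → sumTo N (λ _ → 1ℚ) ≡ fromℕ N
sumTo-1ℚ zero    = refl
sumTo-1ℚ (suc N) = trans (cong (_+ 1ℚ) (sumTo-1ℚ N)) (sym (fromℕ-suc N))

weighted : ℕ → (ℕ → ℚ) → ℕ → ℚ
weighted k X n = inv^ (ℕ.pred n) k * X n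

weightedSum : ℕ → (ℕ → ℚ) → ℕ → ℚ
weightedSum k X N = sumTo N (weighted k X)

weightedSum-suc-fromℕ : ∀ c N → weightedSum (suc c) fromℕ N ≡ sumTo N (λ n → inv^ (ℕ.pred n) c)
weightedSum-suc-fromℕ c zero    = refl
weightedSum-suc-fromℕ c (suc N) = cong₂ _+_ (weightedSum-suc-fromℕ c N) (inv^-suc*fromℕ N c)

ζ⋆≤-≥1 : ∀ ks n → 1ℚ ≤ ζ⋆≤ ks (suc n)
ζ⋆≤-term-≥0 : ∀ k ks n → 0ℚ ≤ inv^ n k * ζ⋆≤ ks (suc n)

ζ⋆≤-≥1 []       n = ℚP.≤-refl
ζ⋆≤-≥1 (k ∷ ks) n = begin
  1ℚ                              ≤⟨ ζ⋆≤-≥1 ks 0 ⟩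
  ζ⋆≤ ks 1                        ≡⟨ trans (ℚP.+-identityˡ _) (ℚP.*-identityˡ (ζ⋆≤ ks 1)) ⟨
  0ℚ + 1ℚ * ζ⋆≤ ks 1              ≡⟨ cong (λ r → 0ℚ + r * ζ⋆≤ ks 1) (inv^-zeroˡ k) ⟨
  ζ⋆≤ (k ∷ ks) 1                  ≤⟨ sumTo-monoˡ {weighted k (ζ⋆≤ ks)} (ζ⋆≤-term-≥0 k ks) {1} {suc n} (s≤s z≤n) ⟩
  ζ⋆≤ (k ∷ ks) (suc n)            ∎
  where open ℚP.≤-Reasoning

ζ⋆≤-term-≥0 k ks n = *-≥0 (inv^-nonNeg n k) (ℚP.≤-trans (ℚP.nonNegative⁻¹ 1ℚ) (ζ⋆≤-≥1 ks n))

-- No margin can be asked for at N = 1, since ζ⋆≤ ks 1 = 1 for every ks.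
record _≫_ (X Y : ℕ → ℚ) : Set where
  constructor dominates
  field
    margin        : ℚ
    margin-pos    : 0ℚ < margin
    ≤-from-1      : ∀ n → Y (suc n) ≤ X (suc n)
    margin-from-2 : ∀ n → Y (2 ℕ.+ n) + margin ≤ X (2 ℕ.+ n)

weightedSum-≫ : ∀ k {X Y} → X ≫ Y → weightedSum k X ≫ weightedSum k Y
weightedSum-≫ k {X} {Y} (dominates ε ε>0 Y≤X Y+ε≤X) =
  dominates (inv^ 1 k * ε) (*-pos (inv^-pos 1 k) ε>0)
    (λ n → sumTo-mono termwise (suc n)) (sumTo-mono-margin termwise margin)
  where
  termwise : ∀ n → weighted k Y (suc n) ≤ weighted k X (suc n)
  termwise n = *-monoˡ-≤-≥0 (inv^ n k) (inv^-nonNeg n k) (Y≤X n)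
  margin : weighted k Y 2 + inv^ 1 k * ε ≤ weighted k X 2
  margin = subst (_≤ weighted k X 2) (ℚP.*-distribˡ-+ (inv^ 1 k) (Y 2) ε)
    (*-monoˡ-≤-≥0 (inv^ 1 k) (inv^-nonNeg 1 k) (Y+ε≤X 0))

++-≫ : ∀ pre {ks ms} → ζ⋆≤ ks ≫ ζ⋆≤ ms → ζ⋆≤ (pre ++ ks) ≫ ζ⋆≤ (pre ++ ms)
++-≫ []        ks≫ms = ks≫ms
++-≫ (k ∷ pre) ks≫ms = weightedSum-≫ k (++-≫ pre ks≫ms)

≫-weakenˡ : ∀ {X X' Y} → (∀ n → X (suc n) ≤ X' (suc n)) → X ≫ Y → X' ≫ Y
≫-weakenˡ X≤X' (dominates ε ε>0 Y≤X Y+ε≤X) =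
  dominates ε ε>0 (λ n → ℚP.≤-trans (Y≤X n) (X≤X' n)) (λ n → ℚP.≤-trans (Y+ε≤X n) (X≤X' (suc n)))

ζ⋆≤-≫-[] : ∀ k ks → ζ⋆≤ (k ∷ ks) ≫ ζ⋆≤ []
ζ⋆≤-≫-[] k ks = dominates (inv^ 1 k) (inv^-pos 1 k) (ζ⋆≤-≥1 (k ∷ ks)) first-two-terms
  where
  first-two-terms : ∀ n → 1ℚ + inv^ 1 k ≤ ζ⋆≤ (k ∷ ks) (2 ℕ.+ n)
  first-two-terms n = begin
    1ℚ + inv^ 1 k         ≤⟨ ℚP.+-mono-≤ (ζ⋆≤-≥1 (k ∷ ks) 0) (≤-*-≥1 (inv^-nonNeg 1 k) (ζ⋆≤-≥1 ks 1)) ⟩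
    ζ⋆≤ (k ∷ ks) 2        ≤⟨ sumTo-monoˡ {weighted k (ζ⋆≤ ks)} (ζ⋆≤-term-≥0 k ks) {2} {2 ℕ.+ n} (s≤s (s≤s z≤n)) ⟩
    ζ⋆≤ (k ∷ ks) (2 ℕ.+ n) ∎
    where open ℚP.≤-Reasoning

fromℕ-≫-ζ⋆≤ : ∀ {ms} → All (1 ℕ.≤_) ms → fromℕ ≫ ζ⋆≤ ms
fromℕ-≫-ζ⋆≤ [] = dominates 1ℚ (ℚP.positive⁻¹ 1ℚ) 1≤fromℕ-suc
  (λ n → subst (1ℚ + 1ℚ ≤_) (sym (fromℕ-suc (suc n))) (ℚP.+-monoˡ-≤ 1ℚ (1≤fromℕ-suc n)))
fromℕ-≫-ζ⋆≤ {suc c ∷ _} (s≤s z≤n ∷ ms≥1) = ≫-weakenˡ bound (weightedSum-≫ (suc c) (fromℕ-≫-ζ⋆≤ ms≥1))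
  where
  bound : ∀ n → weightedSum (suc c) fromℕ (suc n) ≤ fromℕ (suc n)
  bound n = begin
    weightedSum (suc c) fromℕ (suc n)          ≡⟨ weightedSum-suc-fromℕ c (suc n) ⟩
    sumTo (suc n) (λ j → inv^ (ℕ.pred j) c)    ≤⟨ sumTo-mono (λ j → inv^-antitone j (z≤n {c})) (suc n) ⟩
    sumTo (suc n) (λ _ → 1ℚ)                    ≡⟨ sumTo-1ℚ (suc n) ⟩
    fromℕ (suc n)                               ∎
    where open ℚP.≤-Reasoning

ζ⋆≤-≫-head< : ∀ {a c} ks {ms} → a ℕ.≤ c → All (1 ℕ.≤_) ms → ζ⋆≤ (a ∷ ks) ≫ ζ⋆≤ (suc c ∷ ms)
ζ⋆≤-≫-head< {a} {c} ks a≤c ms≥1 = ≫-weakenˡ bound (weightedSum-≫ (suc c) (fromℕ-≫-ζ⋆≤ ms≥1))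
  where
  termwise : ∀ n → inv^ n c ≤ inv^ n a * ζ⋆≤ ks (suc n)
  termwise n = ℚP.≤-trans (inv^-antitone n a≤c) (≤-*-≥1 (inv^-nonNeg n a) (ζ⋆≤-≥1 ks n))
  bound : ∀ n → weightedSum (suc c) fromℕ (suc n) ≤ ζ⋆≤ (a ∷ ks) (suc n)
  bound n = subst (_≤ ζ⋆≤ (a ∷ ks) (suc n)) (sym (weightedSum-suc-fromℕ c (suc n)))
    (sumTo-mono termwise (suc n))

≻⇒≫ : ∀ {ks ms} → All (1 ℕ.≤_) ms → ks ≻ ms → ζ⋆≤ ks ≫ ζ⋆≤ ms
≻⇒≫ {ms = ms} _ (properPrefix k rest refl) =
  subst (λ ms' → ζ⋆≤ (ms ++ k ∷ rest) ≫ ζ⋆≤ ms') (++-identityʳ ms) (++-≫ ms (ζ⋆≤-≫-[] k rest))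
≻⇒≫ ms≥1 (firstDiff pre a (suc c) ks ms refl refl (s≤s a≤c)) with ++⁻ʳ pre ms≥1
... | _ ∷ tail≥1 = ++-≫ pre (ζ⋆≤-≫-head< ks a≤c tail≥1)

≫⇒ζ⋆> : ∀ {ks ms} → ζ⋆≤ ks ≫ ζ⋆≤ ms → ks ζ⋆> ms
≫⇒ζ⋆> (dominates ε ε>0 _ margin) = ε , ε>0 , 2 , λ { (suc (suc n)) (s≤s (s≤s _)) → margin n }

ζ⋆>-asym : ∀ {ks ms} → ks ζ⋆> ms → ¬ ms ζ⋆> ks
ζ⋆>-asym {ks} {ms} (ε , ε>0 , N₀ , ms+ε≤ks) (ε' , ε'>0 , N₁ , ks+ε'≤ms) = ℚP.<-irrefl refl (begin-strict
  ζ⋆≤ ms N        <⟨ <+pos (ζ⋆≤ ms N) ε>0 ⟩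
  ζ⋆≤ ms N + ε    ≤⟨ ms+ε≤ks N (ℕP.m≤m⊔n N₀ N₁) ⟩
  ζ⋆≤ ks N        <⟨ <+pos (ζ⋆≤ ks N) ε'>0 ⟩
  ζ⋆≤ ks N + ε'   ≤⟨ ks+ε'≤ms N (ℕP.m≤n⊔m N₀ N₁) ⟩
  ζ⋆≤ ms N        ∎)
  where
  open ℚP.≤-Reasoning
  N = N₀ ℕ.⊔ N₁
  <+pos : ∀ p {ε} → 0ℚ < ε → p < p + ε
  <+pos p ε>0 = subst (_< p + _) (ℚP.+-identityʳ p) (ℚP.+-monoʳ-< p ε>0)

∷-≻ : ∀ k {ks ms} → ks ≻ ms → (k ∷ ks) ≻ (k ∷ ms)
∷-≻ k (properPrefix x rest eq)            = properPrefix x rest (cong (k ∷_) eq)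
∷-≻ k (firstDiff pre a b ks ms eq eq' a<b) = firstDiff (k ∷ pre) a b ks ms (cong (k ∷_) eq) (cong (k ∷_) eq') a<b

≻-trichotomy : ∀ ks ms → ks ≡ ms ⊎ ks ≻ ms ⊎ ms ≻ ks
≻-trichotomy []       []       = inj₁ refl
≻-trichotomy []       (m ∷ ms) = inj₂ (inj₂ (properPrefix m ms refl))
≻-trichotomy (k ∷ ks) []       = inj₂ (inj₁ (properPrefix k ks refl))
≻-trichotomy (k ∷ ks) (m ∷ ms) with ℕ.<-cmp k m
... | tri< k<m _ _ = inj₂ (inj₁ (firstDiff [] k m ks ms refl refl k<m))
... | tri> _ _ m<k = inj₂ (inj₂ (firstDiff [] m k ms ks refl refl m<k))
... | tri≈ _ refl _ with ≻-trichotomy ks ms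
...   | inj₁ refl          = inj₁ refl
...   | inj₂ (inj₁ ks≻ms) = inj₂ (inj₁ (∷-≻ k ks≻ms))
...   | inj₂ (inj₂ ms≻ks) = inj₂ (inj₂ (∷-≻ k ms≻ks))

InS⇒All≥1 : ∀ {ks} → InS ks → All (1 ℕ.≤_) ks
InS⇒All≥1 (inS k≥2 ks≥1) = ℕP.≤-trans (s≤s z≤n) k≥2 ∷ ks≥1

≻⇒ζ⋆> : ∀ {ks ms} → InS ms → ks ≻ ms → ks ζ⋆> ms
≻⇒ζ⋆> {ks} {ms} ms∈S ks≻ms = ≫⇒ζ⋆> {ks} {ms} (≻⇒≫ (InS⇒All≥1 ms∈S) ks≻ms)

theorem1p2 : (ks ms : List ℕ) → InS ks → InS ms
             → ((ks ≻ ms → ks ζ⋆> ms) × (ks ζ⋆> ms → ks ≻ ms))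
theorem1p2 ks ms ks∈S ms∈S = ≻⇒ζ⋆> ms∈S , ζ⋆>⇒≻
  where
  ζ⋆>⇒≻ : ks ζ⋆> ms → ks ≻ ms
  ζ⋆>⇒≻ ks>ms with ≻-trichotomy ks ms
  ... | inj₁ refl          = ⊥-elim (ζ⋆>-asym {ks} {ks} ks>ms ks>ms)
  ... | inj₂ (inj₁ ks≻ms) = ks≻ms
  ... | inj₂ (inj₂ ms≻ks) = ⊥-elim (ζ⋆>-asym {ks} {ms} ks>ms (≻⇒ζ⋆> ks∈S ms≻ks))
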